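{- If $D$ is a digraph with $d_D^+(u)=d_D^-(u)=1$ for every vertex $u$ of $D$, then ${\rm ndi}(D)=2$.
   Context: All digraphs are finite, without loops and without multiple arcs (opposite arcs allowed). $d_D^+(u)$, $d_D^-(u)$ denote outdegree and indegree of $u$. A (proper) $k$-arc-colouring of $D$ is a map $\gamma$ from $A(D)$ to a set of $k$ colours such that arcs with the same head get distinct colours and arcs with the same tail get distinct colours. $S_\gamma^+(u)$, $S_\gamma^-(u)$ are the sets of colours on arcs with tail $u$, resp. head $u$. $\gamma$ is neighbour-distinguishing if for every arc $uv$, $(S_\gamma^+(u),S_\gamma^-(u))\neq(S_\gamma^+(v),S_\gamma^-(v))$ as ordered pairs. ${\rm ndi}(D)$ is the minimum number of colours of a neighbour-distinguishing arc-colouring of $D$. -}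

module Defs where

open import Data.Nat using (ℕ; _<_)
open import Data.Bool using (Bool; true; false; if_then_else_)
open import Data.Fin using (Fin)
open import Data.List using (map; allFin)
open import Data.Nat.ListAction using (sum)
open import Data.Product using (Σ; ∃; _×_)
open import Relation.Nullary using (¬_)
open import Relation.Binary.PropositionalEquality using (_≡_; _≢_)
open import Function.Bundles using (_⇔_)

-- A finite digraph on vertex set Fin n, given by its arc relation,
-- without loops (multiple arcs impossible; opposite arcs allowed).
record Digraph : Set where
  field
    n        : ℕ
    arc      : Fin n → Fin n → Bool
    loopless : ∀ u → arc u u ≡ false
open Digraph public

outdeg : (D : Digraph) → Fin (n D) → ℕ
outdeg D u = sum (map (λ v → if arc D u v then 1 else 0) (allFin (n D)))

indeg : (D : Digraph) → Fin (n D) → ℕ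
indeg D u = sum (map (λ v → if arc D v u then 1 else 0) (allFin (n D)))

-- An assignment of colours from Fin k to pairs (u , v); only its values on
-- arcs (arc D u v ≡ true) matter.
Colouring : Digraph → ℕ → Set
Colouring D k = Fin (n D) → Fin (n D) → Fin k

Proper : (D : Digraph) {k : ℕ} → Colouring D k → Set
Proper D γ =
  (∀ u v w → arc D u v ≡ true → arc D u w ≡ true → v ≢ w → γ u v ≢ γ u w) ×
  (∀ u v w → arc D u w ≡ true → arc D v w ≡ true → u ≢ v → γ u w ≢ γ v w)

S⁺ : (D : Digraph) {k : ℕ} → Colouring D k → Fin (n D) → Fin k → Set
S⁺ D γ u c = ∃ λ v → arc D u v ≡ true × γ u v ≡ c

S⁻ : (D : Digraph) {k : ℕ} → Colouring D k → Fin (n D) → Fin k → Set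
S⁻ D γ u c = ∃ λ v → arc D v u ≡ true × γ v u ≡ c

SamePair : (D : Digraph) {k : ℕ} → Colouring D k → Fin (n D) → Fin (n D) → Set
SamePair D γ u v =
  (∀ c → S⁺ D γ u c ⇔ S⁺ D γ v c) × (∀ c → S⁻ D γ u c ⇔ S⁻ D γ v c)

NeighbourDistinguishing : (D : Digraph) {k : ℕ} → Colouring D k → Set
NeighbourDistinguishing D γ = ∀ u v → arc D u v ≡ true → ¬ SamePair D γ u v

HasNDColouring : Digraph → ℕ → Set
HasNDColouring D k = Σ (Colouring D k) λ γ → Proper D γ × NeighbourDistinguishing D γ

NdiIs : Digraph → ℕ → Set
NdiIs D k = HasNDColouring D k × (∀ j → j < k → ¬ HasNDColouring D j)

-- Every vertex has exactly one out-arc and one in-arc, so the arc relation is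
-- the graph of a fixed-point-free permutation and D is a disjoint union of
-- directed cycles. Any colouring is then proper, and colouring each arc by a
-- colour c of its tail, an arc uv is distinguished unless the three
-- consecutive vertices pred u, u, v all get the same colour. Choosing c as the
-- parity of the distance (backwards along the cycle) to the cycle's smallest
-- vertex, consecutive vertices differ in colour except across that minimum, so
-- no such monochromatic triple exists. With one colour every vertex sees the
-- same pair ({1}, {1}), so two colours are necessary.
module Submission where

open import Defs
open import Data.Bool using (Bool; true; false; if_then_else_)
open import Data.Empty using (⊥; ⊥-elim)
open import Data.Fin as Fin using (Fin; toℕ; fromℕ<; opposite)
import Data.Fin.Properties as Fin
open import Data.List using (List; _∷_; map; allFin; tabulate)
open import Data.List.Membership.Propositional using (_∈_)
open import Data.List.Membership.Propositional.Properties using (∈-allFin)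
import Data.List.Relation.Unary.All.Properties as All
open import Data.List.Relation.Unary.Any using (here; there)
open import Data.Nat using (ℕ; zero; suc; _+_; _*_; _∸_; _≤_; _<_; _≥_; z≤n; s≤s; _≤?_)
open import Data.Nat.DivMod using (_%_; _/_; m%n<n; m≡m%n+[m/n]*n)
open import Data.Nat.ListAction using (sum)
open import Data.Nat.Properties
  using (+-comm; suc-injective; ≤-trans; ≤-<-trans; ≤-antisym; ≤-pred; <⇒≤; n<1+n; m<n⇒m<1+n;
         m∸n≤m; m<n⇒0<n∸m; m+[n∸m]≡n; ≤-totalOrder)
open import Data.List.Extrema ≤-totalOrder using (argmin; argmin-all; f[argmin]≤f[xs])
open import Data.Product using (∃; _×_; _,_; proj₁; proj₂)
open import Function.Bundles using (mk⇔; Equivalence)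
open import Function.Definitions using (Injective)
open import Relation.Nullary using (¬_; Dec; yes; no)
open import Relation.Nullary.Decidable using (map′)
open import Relation.Binary.PropositionalEquality

countTrue : {A : Set} → (A → Bool) → List A → ℕ
countTrue P xs = sum (map (λ v → if P v then 1 else 0) xs)

module _ {A : Set} (P : A → Bool) where

  countTrue≡1⇒∃ : ∀ xs → countTrue P xs ≡ 1 → ∃ λ v → P v ≡ true
  countTrue≡1⇒∃ (x ∷ xs) count≡1 with P x in Px
  ... | true  = x , Px
  ... | false = countTrue≡1⇒∃ xs count≡1

  countTrue-∈⇒≢0 : ∀ {xs v} → v ∈ xs → P v ≡ true → countTrue P xs ≢ 0
  countTrue-∈⇒≢0 {x ∷ xs} (here refl) Pv rewrite Pv = λ ()
  countTrue-∈⇒≢0 {x ∷ xs} (there v∈xs) Pv with P x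
  ... | true  = λ ()
  ... | false = countTrue-∈⇒≢0 v∈xs Pv

  countTrue≡1⇒unique : ∀ {xs v w} → countTrue P xs ≡ 1 → v ∈ xs → w ∈ xs →
                       P v ≡ true → P w ≡ true → v ≡ w
  countTrue≡1⇒unique _ (here refl) (here refl) _ _ = refl
  countTrue≡1⇒unique count≡1 (here refl) (there w∈xs) Pv Pw rewrite Pv =
    ⊥-elim (countTrue-∈⇒≢0 w∈xs Pw (suc-injective count≡1))
  countTrue≡1⇒unique count≡1 (there v∈xs) (here refl) Pv Pw rewrite Pw =
    ⊥-elim (countTrue-∈⇒≢0 v∈xs Pv (suc-injective count≡1))
  countTrue≡1⇒unique {x ∷ xs} count≡1 (there v∈xs) (there w∈xs) Pv Pw with P x
  ... | true  = ⊥-elim (countTrue-∈⇒≢0 v∈xs Pv (suc-injective count≡1))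
  ... | false = countTrue≡1⇒unique count≡1 v∈xs w∈xs Pv Pw

parity : ℕ → Fin 2
parity zero    = Fin.zero
parity (suc k) = opposite (parity k)

parity-suc : ∀ k → parity (suc k) ≢ parity k
parity-suc k with parity k
... | Fin.zero          = λ ()
... | Fin.suc Fin.zero  = λ ()

module Orbits {N : ℕ} (g : Fin N → Fin N) (g-injective : Injective _≡_ _≡_ g) where

  iter : ℕ → Fin N → Fin N
  iter zero    x = x
  iter (suc k) x = g (iter k x)

  iter-+ : ∀ a b x → iter (a + b) x ≡ iter a (iter b x)
  iter-+ zero    b x = refl
  iter-+ (suc a) b x = cong g (iter-+ a b x)

  iter-suc : ∀ k x → iter (suc k) x ≡ iter k (g x)
  iter-suc k x = trans (cong (λ m → iter m x) (+-comm 1 k)) (iter-+ k 1 x)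

  iter-injective : ∀ k {x y} → iter k x ≡ iter k y → x ≡ y
  iter-injective zero    eq = eq
  iter-injective (suc k) eq = iter-injective k (g-injective eq)

  iter-period : ∀ x → ∃ λ p → 0 < p × p ≤ N × iter p x ≡ x
  iter-period x with Fin.pigeonhole (n<1+n N) (λ (i : Fin (suc N)) → iter (toℕ i) x)
  ... | i , j , a<b , iterₐ≡iterᵦ =
    b ∸ a , m<n⇒0<n∸m a<b , ≤-trans (m∸n≤m b a) (≤-pred (Fin.toℕ<n j)) ,
    sym (iter-injective a (begin
      iter a x                ≡⟨ iterₐ≡iterᵦ ⟩
      iter b x                ≡⟨ cong (λ m → iter m x) (sym (m+[n∸m]≡n (<⇒≤ a<b))) ⟩
      iter (a + (b ∸ a)) x    ≡⟨ iter-+ a (b ∸ a) x ⟩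
      iter a (iter (b ∸ a) x) ∎))
    where
    open ≡-Reasoning
    a b : ℕ
    a = toℕ i
    b = toℕ j

  iter-*-period : ∀ q {p x} → iter p x ≡ x → iter (q * p) x ≡ x
  iter-*-period zero    eq = refl
  iter-*-period (suc q) {p} {x} eq =
    trans (iter-+ p (q * p) x) (trans (cong (iter p) (iter-*-period q eq)) eq)

  iter-reduce : ∀ x k → ∃ λ (i : Fin N) → iter (toℕ i) x ≡ iter k x
  iter-reduce x k with iter-period x
  ... | p@(suc _) , _ , p≤N , iterₚ≡x = fromℕ< k%p<N , (begin
      iter (toℕ (fromℕ< k%p<N)) x       ≡⟨ cong (λ m → iter m x) (Fin.toℕ-fromℕ< k%p<N) ⟩
      iter (k % p) x                    ≡⟨ cong (iter (k % p))
                                                (sym (iter-*-period (k / p) iterₚ≡x)) ⟩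
      iter (k % p) (iter (k / p * p) x) ≡⟨ sym (iter-+ (k % p) (k / p * p) x) ⟩
      iter (k % p + k / p * p) x        ≡⟨ cong (λ m → iter m x) (sym (m≡m%n+[m/n]*n k p)) ⟩
      iter k x                          ∎)
    where
    open ≡-Reasoning
    k%p<N : k % p < N
    k%p<N = ≤-trans (m%n<n k p) p≤N

  iter-returns : ∀ y → ∃ λ m → iter m (g y) ≡ y
  iter-returns y with iter-period y
  ... | suc p , _ , _ , iterₚ≡y = p , trans (sym (iter-suc p y)) iterₚ≡y

  IsOrbitMin : Fin N → Set
  IsOrbitMin w = ∀ k → toℕ w ≤ toℕ (iter k w)

  isOrbitMin? : ∀ w → Dec (IsOrbitMin w)
  isOrbitMin? w = map′
    (λ w≤iters k → let i , eq = iter-reduce w k in subst (λ y → toℕ w ≤ toℕ y) eq (w≤iters i))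
    (λ w≤iters i → w≤iters (toℕ i))
    (Fin.all? (λ i → toℕ w ≤? toℕ (iter (toℕ i) w)))

  orbitMin-reachable : ∀ x → ∃ λ j → j < N × IsOrbitMin (iter j x)
  orbitMin-reachable x = minimal reached
    where
    orbit : List (Fin N)
    orbit = tabulate (λ i → iter (toℕ i) x)

    min : Fin N
    min = argmin toℕ x orbit

    reached : ∃ λ j → j < N × iter j x ≡ min
    reached = argmin-all toℕ {P = λ y → ∃ λ j → j < N × iter j x ≡ y}
      (0 , ≤-<-trans z≤n (Fin.toℕ<n x) , refl)
      (All.tabulate⁺ (λ i → toℕ i , Fin.toℕ<n i , refl))

    min≤orbit : ∀ (i : Fin N) → toℕ min ≤ toℕ (iter (toℕ i) x)
    min≤orbit = All.tabulate⁻ (f[argmin]≤f[xs] {f = toℕ} x orbit)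

    minimal : ∃ (λ j → j < N × iter j x ≡ min) → ∃ λ j → j < N × IsOrbitMin (iter j x)
    minimal (j , j<N , iterⱼ≡min) = j , j<N , λ k →
      let i , eq = iter-reduce x (k + j) in
      subst₂ (λ y z → toℕ y ≤ toℕ z) (sym iterⱼ≡min) (trans eq (iter-+ k j x)) (min≤orbit i)

  orbitMin-consecutive : ∀ {y} → IsOrbitMin y → IsOrbitMin (g y) → g y ≡ y
  orbitMin-consecutive {y} y-min gy-min = Fin.toℕ-injective (≤-antisym gy≤y (y-min 1))
    where
    gy≤y : toℕ (g y) ≤ toℕ y
    gy≤y = let m , iterₘ≡y = iter-returns y in
      subst (λ z → toℕ (g y) ≤ toℕ z) iterₘ≡y (gy-min m)

  -- The first argument is fuel: distToMin k x is the number of backward steps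
  -- from x to an orbit minimum, provided one is reached in fewer than k steps.
  distToMin : ℕ → Fin N → ℕ
  distToMin zero    x = 0
  distToMin (suc k) x with isOrbitMin? x
  ... | yes _ = 0
  ... | no  _ = suc (distToMin k (g x))

  distToMin-fuel : ∀ j k k' x → j < k → j < k' → IsOrbitMin (iter j x) →
                   distToMin k x ≡ distToMin k' x
  distToMin-fuel j (suc k) (suc k') x j<k j<k' reached with isOrbitMin? x
  ... | yes _ = refl
  distToMin-fuel zero (suc k) (suc k') x _ _ reached | no x-not-min =
    ⊥-elim (x-not-min reached)
  distToMin-fuel (suc j) (suc k) (suc k') x (s≤s j<k) (s≤s j<k') reached | no _ =
    cong suc (distToMin-fuel j k k' (g x) j<k j<k' (subst IsOrbitMin (iter-suc j x) reached))

  distToMin-step : ∀ x → ¬ IsOrbitMin x → distToMin N x ≡ suc (distToMin N (g x))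
  distToMin-step x x-not-min with orbitMin-reachable x
  ... | j , j<N , reached =
    trans (distToMin-fuel j N (suc N) x j<N (m<n⇒m<1+n j<N) reached) unfold
    where
    unfold : distToMin (suc N) x ≡ suc (distToMin N (g x))
    unfold with isOrbitMin? x
    ... | yes x-min = ⊥-elim (x-not-min x-min)
    ... | no  _     = refl

  colour : Fin N → Fin 2
  colour x = parity (distToMin N x)

  colour-step : ∀ x → ¬ IsOrbitMin x → colour x ≢ colour (g x)
  colour-step x x-not-min rewrite distToMin-step x x-not-min = parity-suc (distToMin N (g x))

  colour-no-monochromatic-triple : (∀ x → g x ≢ x) → ∀ y →
    colour (g (g y)) ≡ colour (g y) → colour (g y) ≡ colour y → ⊥
  colour-no-monochromatic-triple fixpoint-free y c₂≡c₁ c₁≡c₀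
    with isOrbitMin? (g y) | isOrbitMin? y
  ... | no gy-not-min | _            = colour-step (g y) gy-not-min (sym c₂≡c₁)
  ... | yes _         | no y-not-min = colour-step y y-not-min (sym c₁≡c₀)
  ... | yes gy-min    | yes y-min    = fixpoint-free y (orbitMin-consecutive y-min gy-min)

module UnitDegree (D : Digraph) (deg : ∀ u → outdeg D u ≡ 1 × indeg D u ≡ 1) where

  private
    V : Set
    V = Fin (n D)

  succ : V → V
  succ u = proj₁ (countTrue≡1⇒∃ (arc D u) (allFin (n D)) (proj₁ (deg u)))

  arc-succ : ∀ u → arc D u (succ u) ≡ true
  arc-succ u = proj₂ (countTrue≡1⇒∃ (arc D u) (allFin (n D)) (proj₁ (deg u)))

  pred : V → V
  pred v = proj₁ (countTrue≡1⇒∃ (λ u → arc D u v) (allFin (n D)) (proj₂ (deg v)))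

  arc-pred : ∀ v → arc D (pred v) v ≡ true
  arc-pred v = proj₂ (countTrue≡1⇒∃ (λ u → arc D u v) (allFin (n D)) (proj₂ (deg v)))

  arc-tail-unique : ∀ {u v w} → arc D u v ≡ true → arc D u w ≡ true → v ≡ w
  arc-tail-unique {u} {v} {w} =
    countTrue≡1⇒unique (arc D u) (proj₁ (deg u)) (∈-allFin v) (∈-allFin w)

  arc-head-unique : ∀ {u v w} → arc D u w ≡ true → arc D v w ≡ true → u ≡ v
  arc-head-unique {u} {v} {w} =
    countTrue≡1⇒unique (λ x → arc D x w) (proj₂ (deg w)) (∈-allFin u) (∈-allFin v)

  pred-injective : Injective _≡_ _≡_ pred
  pred-injective {v} {w} pred-v≡pred-w =
    arc-tail-unique (arc-pred v) (subst (λ u → arc D u w ≡ true) (sym pred-v≡pred-w) (arc-pred w))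

  pred-fixpoint-free : ∀ v → pred v ≢ v
  pred-fixpoint-free v pred-v≡v
    with trans (sym (subst (λ u → arc D u v ≡ true) pred-v≡v (arc-pred v))) (loopless D v)
  ... | ()

  proper : ∀ {k} (γ : Colouring D k) → Proper D γ
  proper γ = (λ _ _ _ uv uw v≢w _ → v≢w (arc-tail-unique uv uw))
           , (λ _ _ _ uw vw u≢v _ → u≢v (arc-head-unique uw vw))

  tailColouring : ∀ {k} → (V → Fin k) → Colouring D k
  tailColouring c u _ = c u

  tailColouring-nd : ∀ {k} (c : V → Fin k) →
    (∀ v → c (pred (pred v)) ≡ c (pred v) → c (pred v) ≡ c v → ⊥) →
    NeighbourDistinguishing D (tailColouring c)
  tailColouring-nd c no-triple u v uv (same⁺ , same⁻)
    with Equivalence.to (same⁺ (c u)) (v , uv , refl)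
       | Equivalence.to (same⁻ (c (pred u))) (pred u , arc-pred u , refl)
  ... | _ , _ , cv≡cu | y , yv , cy≡c-pred-u = no-triple v
      (subst (λ x → c (pred x) ≡ c x) u≡pred-v (sym (trans (cong c u≡y) cy≡c-pred-u)))
      (subst (λ x → c x ≡ c v) u≡pred-v (sym cv≡cu))
    where
    u≡pred-v : u ≡ pred v
    u≡pred-v = arc-head-unique uv (arc-pred v)
    u≡y : u ≡ y
    u≡y = arc-head-unique uv yv

  samePair-1 : (γ : Colouring D 1) → ∀ u v → SamePair D γ u v
  samePair-1 γ u v = (λ _ → mk⇔ (λ _ → out v) (λ _ → out u))
                         , (λ _ → mk⇔ (λ _ → into v) (λ _ → into u))
    where
    sole : ∀ {c c' : Fin 1} → c ≡ c'
    sole {Fin.zero} {Fin.zero} = refl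
    out : ∀ {c} w → S⁺ D γ w c
    out w = succ w , arc-succ w , sole
    into : ∀ {c} w → S⁻ D γ w c
    into w = pred w , arc-pred w , sole

  no-ndColouring-0 : V → ¬ HasNDColouring D 0
  no-ndColouring-0 u (γ , _) = Fin.¬Fin0 (γ u u)

  no-ndColouring-1 : V → ¬ HasNDColouring D 1
  no-ndColouring-1 u (γ , _ , nd) = nd u (succ u) (arc-succ u) (samePair-1 γ u (succ u))

proposition5 : (D : Digraph) → n D ≥ 1 →
    (∀ u → outdeg D u ≡ 1 × indeg D u ≡ 1) → NdiIs D 2
proposition5 D n≥1 deg = (tailColouring colour , proper _ , distinguishing) , fewer
  where
  open UnitDegree D deg
  open Orbits pred pred-injective

  distinguishing : NeighbourDistinguishing D (tailColouring colour)
  distinguishing = tailColouring-nd colour (colour-no-monochromatic-triple pred-fixpoint-free)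

  fewer : ∀ j → j < 2 → ¬ HasNDColouring D j
  fewer 0 _ = no-ndColouring-0 (fromℕ< n≥1)
  fewer 1 _ = no-ndColouring-1 (fromℕ< n≥1)
  fewer (suc (suc _)) (s≤s (s≤s ()))
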